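{- Let $k\ge 2$ and let $G$ be a finite simple graph that is claw-free and minimal $k$-factor-critical. Let $uv$ be an edge of $G$ (with $d_G(u),d_G(v)\ge k+2$) that is of type 1, and let $S_{uv}$ be the associated set. Then $S_{uv}\cup\{v\}$ is a $(k+1)$-vertex cut of $G$ satisfying Property $Q$ with respect to $u$ (for the edge $uv$), and symmetrically $S_{uv}\cup\{u\}$ is a $(k+1)$-vertex cut satisfying Property $Q$ with respect to $v$.
   Context: A graph $G$ of order $n$ is $k$-factor-critical (for $1\le k<n$) if for every set $X$ of $k$ vertices, $G-X$ has a perfect matching; it is minimal if deleting any edge yields a graph that is not $k$-factor-critical. Claw-free means no induced $K_{1,3}$. Types of edges: for an edge $e=uv$ with $d_G(u),d_G(v)\ge k+2$, let $S_e$ (here $S_{uv}$) be a set of smallest cardinality among all $S\subseteq V(G)\setminus\{u,v\}$ with $|S|\ge k$ such that $G-e-S$ has exactly $|S|-k+2$ odd components (components with an odd number of vertices) and $u,v$ lie in distinct odd components of $G-e-S$. The edge $e$ is of type 1 if $|S_e|=k$, $G-e-S_e$ has exactly two odd components, no even components, and both odd components have more than one vertex; otherwise it is of type 2. Property $Q$: for an edge $e=uv$, a vertex cut $X\subseteq V(G)$ satisfies Property $Q$ with respect to $u$ if (i) $|X|=k+1$; (ii) $v\in X$; (iii) $u$ lies in an odd component $C_u$ of $G-X$; and (iv) the only edge of $G$ between $V(C_u)$ and $v$ is $uv$. Property $Q$ with respect to $v$ is defined symmetrically (swap the roles of $u$ and $v$). -}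

module Defs where

open import Data.Nat using (ℕ; zero; suc; _+_; _∸_; _≤_; _<_)
open import Data.Nat.Base using (_<ᵇ_)
open import Data.Bool using (Bool; true; false; _∧_; _∨_; not; if_then_else_)
open import Data.Fin using (Fin; toℕ)
open import Data.Fin.Subset using (Subset; _∪_; _∩_; ∁; ⁅_⁆; ∣_∣)
open import Data.Vec using (lookup; tabulate)
open import Data.Product using (Σ; _×_)
open import Relation.Binary.PropositionalEquality using (_≡_; _≢_)
open import Relation.Nullary using (¬_)

Adj : ℕ → Set
Adj n = Fin n → Fin n → Bool

record IsSimple {n : ℕ} (A : Adj n) : Set where
  field
    sym    : ∀ x y → A x y ≡ A y x
    irrefl : ∀ x → A x x ≡ false

anyFin : ∀ {n} → (Fin n → Bool) → Bool
anyFin {zero}  f = false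
anyFin {suc n} f = f Data.Fin.zero ∨ anyFin (λ i → f (Data.Fin.suc i))

count : ∀ {n} → (Fin n → Bool) → ℕ
count {zero}  f = 0
count {suc n} f = (if f Data.Fin.zero then 1 else 0) + count (λ i → f (Data.Fin.suc i))

isOdd : ℕ → Bool
isOdd zero = false
isOdd (suc m) = not (isOdd m)

iter : {X : Set} → ℕ → (X → X) → X → X
iter zero    f x = x
iter (suc m) f x = f (iter m f x)

deg : ∀ {n} → Adj n → Fin n → ℕ
deg A u = count (A u)

delEdge : ∀ {n} → Adj n → Fin n → Fin n → Adj n
delEdge A u v x y =
  A x y ∧ not ((⌊eq⌋ x u ∧ ⌊eq⌋ y v) ∨ (⌊eq⌋ x v ∧ ⌊eq⌋ y u))
  where
  ⌊eq⌋ : ∀ {n} → Fin n → Fin n → Bool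
  ⌊eq⌋ a b = Relation.Nullary.Decidable.⌊ a Data.Fin.≟ b ⌋
    where import Relation.Nullary.Decidable

expand : ∀ {n} → Adj n → Subset n → Subset n → Subset n
expand A W R = R ∪ tabulate (λ y → lookup W y ∧ anyFin (λ x → lookup R x ∧ A x y))

-- The vertex set of the component containing x of the induced subgraph G[W]
-- (empty if x ∉ W).  n iterations suffice to reach everything reachable.
comp : ∀ {n} → Adj n → Subset n → Fin n → Subset n
comp {n} A W x = iter n (expand A W) (⁅ x ⁆ ∩ W)

isRep : ∀ {n} → Adj n → Subset n → Fin n → Bool
isRep A W x = lookup W x ∧ not (anyFin (λ y → lookup (comp A W x) y ∧ (toℕ y <ᵇ toℕ x)))

numComps : ∀ {n} → Adj n → Subset n → ℕ
numComps A W = count (λ x → isRep A W x)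

oddComps : ∀ {n} → Adj n → Subset n → ℕ
oddComps A W = count (λ x → isRep A W x ∧ isOdd ∣ comp A W x ∣)

evenComps : ∀ {n} → Adj n → Subset n → ℕ
evenComps A W = count (λ x → isRep A W x ∧ not (isOdd ∣ comp A W x ∣))

-- G[W] has a perfect matching (given as a fixed-point-free involution on W along edges)
HasPerfectMatching : ∀ {n} → Adj n → Subset n → Set
HasPerfectMatching {n} A W =
  Σ (Fin n → Fin n) λ p → ∀ x → lookup W x ≡ true →
    (lookup W (p x) ≡ true) × (A x (p x) ≡ true) × (p (p x) ≡ x)

FactorCritical : ∀ {n} → Adj n → ℕ → Set
FactorCritical {n} A k =
  (1 ≤ k) × (k < n) × (∀ (X : Subset n) → ∣ X ∣ ≡ k → HasPerfectMatching A (∁ X))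

MinimalFactorCritical : ∀ {n} → Adj n → ℕ → Set
MinimalFactorCritical A k =
  FactorCritical A k × (∀ x y → A x y ≡ true → ¬ FactorCritical (delEdge A x y) k)

ClawFree : ∀ {n} → Adj n → Set
ClawFree {n} A = ∀ (c a b d : Fin n) →
  A c a ≡ true → A c b ≡ true → A c d ≡ true →
  a ≢ b → a ≢ d → b ≢ d →
  ¬ ((A a b ≡ false) × (A a d ≡ false) × (A b d ≡ false))

Admissible : ∀ {n} → Adj n → ℕ → Fin n → Fin n → Subset n → Set
Admissible A k u v S =
  (lookup S u ≡ false) × (lookup S v ≡ false) × (k ≤ ∣ S ∣) ×
  (oddComps (delEdge A u v) (∁ S) ≡ (∣ S ∣ ∸ k) + 2) ×
  (isOdd ∣ comp (delEdge A u v) (∁ S) u ∣ ≡ true) ×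
  (isOdd ∣ comp (delEdge A u v) (∁ S) v ∣ ≡ true) ×
  (lookup (comp (delEdge A u v) (∁ S) u) v ≡ false)

IsSuv : ∀ {n} → Adj n → ℕ → Fin n → Fin n → Subset n → Set
IsSuv {n} A k u v S =
  Admissible A k u v S × (∀ (S' : Subset n) → Admissible A k u v S' → ∣ S ∣ ≤ ∣ S' ∣)

Type1 : ∀ {n} → Adj n → ℕ → Fin n → Fin n → Subset n → Set
Type1 {n} A k u v S =
  (∣ S ∣ ≡ k) × (oddComps (delEdge A u v) (∁ S) ≡ 2) ×
  (evenComps (delEdge A u v) (∁ S) ≡ 0) ×
  (∀ (x : Fin n) → lookup (∁ S) x ≡ true →
     isOdd ∣ comp (delEdge A u v) (∁ S) x ∣ ≡ true →
     1 < ∣ comp (delEdge A u v) (∁ S) x ∣)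

VertexCut : ∀ {n} → Adj n → Subset n → Set
VertexCut A X = 2 ≤ numComps A (∁ X)

PropertyQ : ∀ {n} → Adj n → ℕ → Fin n → Fin n → Subset n → Set
PropertyQ {n} A k u v X =
  (∣ X ∣ ≡ suc k) × (lookup X v ≡ true) × (lookup X u ≡ false) ×
  (isOdd ∣ comp A (∁ X) u ∣ ≡ true) ×
  (∀ (w : Fin n) → lookup (comp A (∁ X) u) w ≡ true → A w v ≡ true → w ≡ u)

{-# OPTIONS --safe #-}
-- In G − uv − S the component C of u is odd and avoids v.  Removing v instead of the edge uv
-- leaves C unchanged, and because v ∉ C, uv is the only edge of G between C and v: this is
-- Property Q.  The type-1 condition says the component of v has a second vertex w; it is not
-- in C and survives the removal of v, so S ∪ {v} separates u from w.
module Submission where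

open import Defs
open import Data.Nat using (ℕ; zero; suc; _+_; _≤_; _<_; _<ᵇ_; z≤n; s≤s)
open import Data.Nat.Properties using (<ᵇ⇒<; <⇒≱; ≤-<-trans; ≤-trans; ≤-reflexive)
open import Data.Bool using (Bool; true; false; _∧_; _∨_; not; T)
open import Data.Bool.Properties using (∧-comm; ∨-comm; ∧-conicalˡ; ∧-conicalʳ)
open import Data.Fin using (Fin; toℕ; _≟_)
import Data.Fin as Fin
open import Data.Fin.Induction using (<-wellFounded)
open import Data.Fin.Properties using (any?)
open import Data.Fin.Subset using (Subset; _∈_; _∉_; _⊆_; _⊂_; _∪_; _∩_; ∁; ⁅_⁆; ∣_∣)
open import Data.Fin.Subset.Properties
  using (_∈?_; ⊆-antisym; p⊆q⇒∣p∣≤∣q∣; p⊂q⇒∣p∣<∣q∣; ∣p∣≤n; ∣⁅x⁆∣≡1; x∈⁅x⁆; x∈⁅y⁆⇒x≡y;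
         ∪-identityʳ; p⊆p∪q; x∈p∪q⁺; x∈p∪q⁻; p∩q⊆q; x∈p∩q⁺; x∈p∩q⁻; x∈∁p⇒x∉p; x∉p⇒x∈∁p)
open import Data.Vec using (_∷_; lookup; tabulate)
open import Data.Vec.Properties using (lookup∘tabulate; []=⇒lookup; lookup⇒[]=)
open import Data.Vec.Base using (here; there)
open import Data.Product using (∃; _×_; _,_; proj₁; proj₂)
open import Data.Sum using (_⊎_; inj₁; inj₂; [_,_]′)
open import Data.Empty using (⊥-elim)
open import Data.Unit using (tt)
open import Function using (_∘_)
open import Induction.WellFounded using (Acc; acc)
open import Relation.Binary.PropositionalEquality
open import Relation.Nullary using (¬_; yes; no; ¬?)
open import Relation.Nullary.Decidable using (⌊_⌋; _×-dec_; decidable-stable)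

∧≡true⁻ : ∀ {a b} → a ∧ b ≡ true → a ≡ true × b ≡ true
∧≡true⁻ {a} {b} eq = ∧-conicalˡ a b eq , ∧-conicalʳ a b eq

≡true⇒T : ∀ {b} → b ≡ true → T b
≡true⇒T refl = tt

anyFin⁺ : ∀ {n} (f : Fin n → Bool) {x} → f x ≡ true → anyFin f ≡ true
anyFin⁺ f {Fin.zero} fx rewrite fx = refl
anyFin⁺ f {Fin.suc x} fx with f Fin.zero
... | true  = refl
... | false = anyFin⁺ (f ∘ Fin.suc) fx

anyFin⁻ : ∀ {n} (f : Fin n → Bool) → anyFin f ≡ true → ∃ λ x → f x ≡ true
anyFin⁻ {suc n} f any with f Fin.zero in f0
... | true  = Fin.zero , f0
... | false with anyFin⁻ (f ∘ Fin.suc) any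
...   | x , fx = Fin.suc x , fx

1≤count : ∀ {n} (f : Fin n → Bool) {a} → f a ≡ true → 1 ≤ count f
1≤count f {Fin.zero} fa rewrite fa = s≤s z≤n
1≤count f {Fin.suc a} fa with f Fin.zero
... | true  = s≤s z≤n
... | false = 1≤count (f ∘ Fin.suc) fa

2≤count : ∀ {n} (f : Fin n → Bool) {a b} → f a ≡ true → f b ≡ true → a ≢ b → 2 ≤ count f
2≤count f {Fin.zero}  {Fin.zero}  _  _  a≢b = ⊥-elim (a≢b refl)
2≤count f {Fin.zero}  {Fin.suc b} fa fb _   rewrite fa = s≤s (1≤count (f ∘ Fin.suc) fb)
2≤count f {Fin.suc a} {Fin.zero}  fa fb _   rewrite fb = s≤s (1≤count (f ∘ Fin.suc) fa)
2≤count f {Fin.suc a} {Fin.suc b} fa fb a≢b with f Fin.zero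
... | true  = s≤s (1≤count (f ∘ Fin.suc) fa)
... | false = 2≤count (f ∘ Fin.suc) fa fb (a≢b ∘ cong Fin.suc)

lookup≡false⇒∉ : ∀ {n} {p : Subset n} {x} → lookup p x ≡ false → x ∉ p
lookup≡false⇒∉ px x∈p with trans (sym ([]=⇒lookup x∈p)) px
... | ()

∉⇒lookup≡false : ∀ {n} {p : Subset n} {x} → x ∉ p → lookup p x ≡ false
∉⇒lookup≡false {p = p} {x} x∉p with lookup p x in px
... | false = refl
... | true  = ⊥-elim (x∉p (lookup⇒[]= x p px))

∈tabulate⁺ : ∀ {n} {f : Fin n → Bool} {x} → f x ≡ true → x ∈ tabulate f
∈tabulate⁺ {f = f} {x} fx = lookup⇒[]= x (tabulate f) (trans (lookup∘tabulate f x) fx)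

∈tabulate⁻ : ∀ {n} {f : Fin n → Bool} {x} → x ∈ tabulate f → f x ≡ true
∈tabulate⁻ {f = f} {x} x∈ = trans (sym (lookup∘tabulate f x)) ([]=⇒lookup x∈)

⊆⇒≡⊎⊂ : ∀ {n} {p q : Subset n} → p ⊆ q → p ≡ q ⊎ p ⊂ q
⊆⇒≡⊎⊂ {p = p} {q} p⊆q with any? (λ x → x ∈? q ×-dec ¬? (x ∈? p))
... | yes (x , x∈q , x∉p) = inj₂ (p⊆q , x , x∈q , x∉p)
... | no ∄ = inj₁ (⊆-antisym p⊆q q⊆p)
  where
  q⊆p : q ⊆ p
  q⊆p {x} x∈q = decidable-stable (x ∈? p) (λ x∉p → ∄ (x , x∈q , x∉p))

∣p∪⁅x⁆∣≡1+∣p∣ : ∀ {n} (p : Subset n) x → x ∉ p → ∣ p ∪ ⁅ x ⁆ ∣ ≡ suc ∣ p ∣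
∣p∪⁅x⁆∣≡1+∣p∣ (false ∷ p) Fin.zero    _   = cong suc (cong ∣_∣ (∪-identityʳ p))
∣p∪⁅x⁆∣≡1+∣p∣ (true  ∷ p) Fin.zero    x∉p = ⊥-elim (x∉p here)
∣p∪⁅x⁆∣≡1+∣p∣ (false ∷ p) (Fin.suc x) x∉p = ∣p∪⁅x⁆∣≡1+∣p∣ p x (x∉p ∘ there)
∣p∪⁅x⁆∣≡1+∣p∣ (true  ∷ p) (Fin.suc x) x∉p = cong suc (∣p∪⁅x⁆∣≡1+∣p∣ p x (x∉p ∘ there))

1<∣p∣⇒∃y≢x∈p : ∀ {n} (p : Subset n) x → 1 < ∣ p ∣ → ∃ λ y → y ∈ p × y ≢ x
1<∣p∣⇒∃y≢x∈p p x 1<∣p∣ with any? (λ y → y ∈? p ×-dec ¬? (y ≟ x))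
... | yes found = found
... | no ∄ = ⊥-elim (<⇒≱ 1<∣p∣ (≤-trans (p⊆q⇒∣p∣≤∣q∣ p⊆⁅x⁆) (≤-reflexive (∣⁅x⁆∣≡1 x))))
  where
  p⊆⁅x⁆ : p ⊆ ⁅ x ⁆
  p⊆⁅x⁆ {y} y∈p with y ≟ x
  ... | yes refl = x∈⁅x⁆ x
  ... | no y≢x   = ⊥-elim (∄ (y , y∈p , y≢x))

∈∁[p∪⁅x⁆]⁻ : ∀ {n} {p : Subset n} {x y} → y ∈ ∁ (p ∪ ⁅ x ⁆) → y ∈ ∁ p × y ≢ x
∈∁[p∪⁅x⁆]⁻ y∈ = x∉p⇒x∈∁p (y∉ ∘ x∈p∪q⁺ ∘ inj₁) , λ { refl → y∉ (x∈p∪q⁺ (inj₂ (x∈⁅x⁆ _))) }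
  where y∉ = x∈∁p⇒x∉p y∈

∈∁[p∪⁅x⁆]⁺ : ∀ {n} {p : Subset n} {x y} → y ∈ ∁ p → y ≢ x → y ∈ ∁ (p ∪ ⁅ x ⁆)
∈∁[p∪⁅x⁆]⁺ {p = p} {x} y∈∁p y≢x =
  x∉p⇒x∈∁p (λ y∈ → [ x∈∁p⇒x∉p y∈∁p , y≢x ∘ x∈⁅y⁆⇒x≡y x ]′ (x∈p∪q⁻ p ⁅ x ⁆ y∈))

module _ {n} (f : Subset n → Subset n) where

  iter-⊇ : (∀ R → R ⊆ f R) → ∀ m {R} → R ⊆ iter m f R
  iter-⊇ inflationary zero    x∈R = x∈R
  iter-⊇ inflationary (suc m) x∈R = inflationary _ (iter-⊇ inflationary m x∈R)

  iter-⊆ : ∀ {Q} → (∀ {R} → R ⊆ Q → f R ⊆ Q) → ∀ m {R} → R ⊆ Q → iter m f R ⊆ Q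
  iter-⊆ preserves zero    R⊆Q = R⊆Q
  iter-⊆ preserves (suc m) R⊆Q = preserves (iter-⊆ preserves m R⊆Q)

  module _ (inflationary : ∀ R → R ⊆ f R) where

    -- every step that is not a fixed point adds a vertex, so after n steps one has been reached
    iter-fixed-or-growing : ∀ m R → f (iter m f R) ≡ iter m f R ⊎ m < ∣ iter (suc m) f R ∣
    iter-fixed-or-growing zero R with ⊆⇒≡⊎⊂ (inflationary R)
    ... | inj₁ R≡fR = inj₁ (sym R≡fR)
    ... | inj₂ R⊂fR = inj₂ (≤-<-trans z≤n (p⊂q⇒∣p∣<∣q∣ R⊂fR))
    iter-fixed-or-growing (suc m) R with iter-fixed-or-growing m R
    ... | inj₁ fixed = inj₁ (cong f fixed)
    ... | inj₂ m<∣Rₘ₊₁∣ with ⊆⇒≡⊎⊂ (inflationary (iter (suc m) f R))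
    ...   | inj₁ Rₘ₊₁≡fRₘ₊₁ = inj₁ (sym Rₘ₊₁≡fRₘ₊₁)
    ...   | inj₂ Rₘ₊₁⊂fRₘ₊₁ = inj₂ (≤-<-trans m<∣Rₘ₊₁∣ (p⊂q⇒∣p∣<∣q∣ Rₘ₊₁⊂fRₘ₊₁))

    iter-fixed : ∀ R → f (iter n f R) ≡ iter n f R
    iter-fixed R with iter-fixed-or-growing n R
    ... | inj₁ fixed  = fixed
    ... | inj₂ n<∣Rₙ₊₁∣ = ⊥-elim (<⇒≱ n<∣Rₙ₊₁∣ (∣p∣≤n (iter (suc n) f R)))

SymmetricAdj : ∀ {n} → Adj n → Set
SymmetricAdj {n} A = ∀ (x y : Fin n) → A x y ≡ A y x

module Components {n} (A : Adj n) (W : Subset n) where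

  Closed : Subset n → Set
  Closed Q = ∀ {x y} → x ∈ Q → y ∈ W → A x y ≡ true → y ∈ Q

  ∈expand⁺ : ∀ {R x y} → x ∈ R → y ∈ W → A x y ≡ true → y ∈ expand A W R
  ∈expand⁺ {R} {x} x∈R y∈W Axy = x∈p∪q⁺ (inj₂ (∈tabulate⁺
    (cong₂ _∧_ ([]=⇒lookup y∈W) (anyFin⁺ _ {x} (cong₂ _∧_ ([]=⇒lookup x∈R) Axy)))))

  expand-⊆ : ∀ {Q R} → Closed Q → R ⊆ Q → expand A W R ⊆ Q
  expand-⊆ {R = R} closed R⊆Q y∈ with x∈p∪q⁻ R _ y∈
  ... | inj₁ y∈R = R⊆Q y∈R
  ... | inj₂ y∈new with ∧≡true⁻ (∈tabulate⁻ y∈new)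
  ...   | y∈W , edge with anyFin⁻ _ edge
  ...     | x , x∈R∧Axy with ∧≡true⁻ x∈R∧Axy
  ...       | x∈R , Axy = closed (R⊆Q (lookup⇒[]= x R x∈R)) (lookup⇒[]= _ W y∈W) Axy

  comp-⊆ : ∀ {x} → comp A W x ⊆ W
  comp-⊆ = iter-⊆ (expand A W) (expand-⊆ (λ _ y∈W _ → y∈W)) n (p∩q⊆q _ _)

  comp-∋ : ∀ {x} → x ∈ W → x ∈ comp A W x
  comp-∋ {x} x∈W = iter-⊇ (expand A W) (λ _ → p⊆p∪q _) n (x∈p∩q⁺ (x∈⁅x⁆ x , x∈W))

  comp-closed : ∀ {x} → Closed (comp A W x)
  comp-closed {x} y∈C z∈W Ayz =
    subst (_ ∈_) (iter-fixed (expand A W) (λ _ → p⊆p∪q _) _) (∈expand⁺ y∈C z∈W Ayz)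

  comp-least : ∀ {x Q} → x ∈ Q → Closed Q → comp A W x ⊆ Q
  comp-least {x} {Q} x∈Q closed = iter-⊆ (expand A W) (expand-⊆ closed) n seed⊆Q
    where
    seed⊆Q : ⁅ x ⁆ ∩ W ⊆ Q
    seed⊆Q y∈ with x∈⁅y⁆⇒x≡y x (proj₁ (x∈p∩q⁻ _ _ y∈))
    ... | refl = x∈Q

  comp-⊆-comp : ∀ {x y} → y ∈ comp A W x → comp A W y ⊆ comp A W x
  comp-⊆-comp y∈Cx = comp-least y∈Cx comp-closed

  module _ (A-sym : SymmetricAdj A) where

    comp-sym : ∀ {x y} → x ∈ W → y ∈ comp A W x → x ∈ comp A W y
    comp-sym {x} x∈W y∈Cx = proj₂ (∈Q⁻ (comp-least (∈Q⁺ x∈W (comp-∋ x∈W)) Q-closed y∈Cx))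
      where
      Q : Subset n
      Q = tabulate (λ z → lookup W z ∧ lookup (comp A W z) x)

      ∈Q⁺ : ∀ {z} → z ∈ W → x ∈ comp A W z → z ∈ Q
      ∈Q⁺ z∈W x∈Cz = ∈tabulate⁺ (cong₂ _∧_ ([]=⇒lookup z∈W) ([]=⇒lookup x∈Cz))

      ∈Q⁻ : ∀ {z} → z ∈ Q → z ∈ W × x ∈ comp A W z
      ∈Q⁻ {z} z∈Q with ∧≡true⁻ (∈tabulate⁻ z∈Q)
      ... | z∈W , x∈Cz = lookup⇒[]= z W z∈W , lookup⇒[]= x _ x∈Cz

      Q-closed : Closed Q
      Q-closed {z} {z'} z∈Q z'∈W Azz' with ∈Q⁻ z∈Q
      ... | z∈W , x∈Cz = ∈Q⁺ z'∈W (comp-⊆-comp z∈Cz' x∈Cz)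
        where
        z∈Cz' = comp-closed (comp-∋ z'∈W) z∈W (trans (A-sym z' z) Azz')

    comp-meet : ∀ {x y z} → y ∈ W → z ∈ comp A W x → z ∈ comp A W y → y ∈ comp A W x
    comp-meet y∈W z∈Cx z∈Cy = comp-⊆-comp z∈Cx (comp-sym y∈W z∈Cy)

  comp-has-rep : ∀ {y} → y ∈ W → ∃ λ r → isRep A W r ≡ true × r ∈ comp A W y
  comp-has-rep = go (<-wellFounded _)
    where
    go : ∀ {y} → Acc Fin._<_ y → y ∈ W → ∃ λ r → isRep A W r ≡ true × r ∈ comp A W y
    go {y} (acc below) y∈W with anyFin (λ z → lookup (comp A W y) z ∧ (toℕ z <ᵇ toℕ y)) in smaller
    ... | false = y , cong₂ (λ a b → a ∧ not b) ([]=⇒lookup y∈W) smaller , comp-∋ y∈W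
    ... | true with anyFin⁻ _ smaller
    ...   | z , z∈Cy∧z<y with ∧≡true⁻ z∈Cy∧z<y
    ...     | z∈Cy , z<y with go (below (<ᵇ⇒< _ _ (≡true⇒T z<y))) (comp-⊆ (lookup⇒[]= z _ z∈Cy))
    ...       | r , r-rep , r∈Cz = r , r-rep , comp-⊆-comp (lookup⇒[]= z _ z∈Cy) r∈Cz

  two-components : SymmetricAdj A → ∀ {x y} → x ∈ W → y ∈ W → y ∉ comp A W x →
                   2 ≤ numComps A W
  two-components A-sym {x} {y} x∈W y∈W y∉Cx with comp-has-rep x∈W | comp-has-rep y∈W
  ... | r , r-rep , r∈Cx | s , s-rep , s∈Cy = 2≤count (isRep A W) r-rep s-rep r≢s
    where
    r≢s : r ≢ s
    r≢s refl = y∉Cx (comp-meet A-sym y∈W r∈Cx s∈Cy)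

record WithoutEdge {n} (A : Adj n) (u v : Fin n) (B : Adj n) : Set where
  field
    sub  : ∀ {x y} → B x y ≡ true → A x y ≡ true
    keep : ∀ {x y} → ¬ (x ≡ u × y ≡ v) → ¬ (x ≡ v × y ≡ u) → A x y ≡ true → B x y ≡ true

WithoutEdge-swap : ∀ {n} {A B : Adj n} {u v} → WithoutEdge A u v B → WithoutEdge A v u B
WithoutEdge-swap del = record { sub = sub ; keep = λ not-vu not-uv → keep not-uv not-vu }
  where open WithoutEdge del

⌊≟⌋-pair-false : ∀ {n} {x y a b : Fin n} → ¬ (x ≡ a × y ≡ b) → ⌊ x ≟ a ⌋ ∧ ⌊ y ≟ b ⌋ ≡ false
⌊≟⌋-pair-false {x = x} {y} {a} {b} ¬x≡a×y≡b with x ≟ a | y ≟ b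
... | no _    | _       = refl
... | yes _   | no _    = refl
... | yes x≡a | yes y≡b = ⊥-elim (¬x≡a×y≡b (x≡a , y≡b))

module _ {n} (A : Adj n) (u v : Fin n) where

  delEdge-WithoutEdge : WithoutEdge A u v (delEdge A u v)
  delEdge-WithoutEdge = record
    { sub  = proj₁ ∘ ∧≡true⁻
    ; keep = λ not-uv not-vu Axy →
        cong₂ (λ a b → a ∧ not b) Axy (cong₂ _∨_ (⌊≟⌋-pair-false not-uv) (⌊≟⌋-pair-false not-vu))
    }

  delEdge-sym : SymmetricAdj A → SymmetricAdj (delEdge A u v)
  delEdge-sym A-sym x y = cong₂ (λ a b → a ∧ not b) (A-sym x y) (begin
    (⌊ x ≟ u ⌋ ∧ ⌊ y ≟ v ⌋) ∨ (⌊ x ≟ v ⌋ ∧ ⌊ y ≟ u ⌋)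
      ≡⟨ ∨-comm (⌊ x ≟ u ⌋ ∧ ⌊ y ≟ v ⌋) _ ⟩
    (⌊ x ≟ v ⌋ ∧ ⌊ y ≟ u ⌋) ∨ (⌊ x ≟ u ⌋ ∧ ⌊ y ≟ v ⌋)
      ≡⟨ cong₂ _∨_ (∧-comm ⌊ x ≟ v ⌋ _) (∧-comm ⌊ x ≟ u ⌋ _) ⟩
    (⌊ y ≟ u ⌋ ∧ ⌊ x ≟ v ⌋) ∨ (⌊ y ≟ v ⌋ ∧ ⌊ x ≟ u ⌋) ∎)
    where open ≡-Reasoning

module _ {n} {A B : Adj n} {u v : Fin n} (del : WithoutEdge A u v B) (u≢v : u ≢ v) where
  open WithoutEdge del

  comp-neighbour-of-endpoint : ∀ {W w} → v ∈ W → v ∉ comp B W u →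
                               w ∈ comp B W u → A w v ≡ true → w ≡ u
  comp-neighbour-of-endpoint {W} {w} v∈W v∉Cu w∈Cu Awv with w ≟ u
  ... | yes w≡u = w≡u
  ... | no w≢u  = ⊥-elim (v∉Cu (Components.comp-closed B W w∈Cu v∈W
                   (keep (w≢u ∘ proj₁) (u≢v ∘ sym ∘ proj₂) Awv)))

  comp-delete-endpoint : ∀ {W W'} → (∀ {y} → y ∈ W' → y ∈ W × y ≢ v) →
                         (∀ {y} → y ∈ W → y ≢ v → y ∈ W') →
                         u ∈ W → v ∉ comp B W u → comp A W' u ≡ comp B W u
  comp-delete-endpoint {W} {W'} W'⊆W∖v W∖v⊆W' u∈W v∉Cu = ⊆-antisym C'⊆C C⊆C'
    where
    module C  = Components B W
    module C' = Components A W'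

    ≢v-in-C : ∀ {x} → x ∈ comp B W u → x ≢ v
    ≢v-in-C x∈C refl = v∉Cu x∈C

    C'⊆C : comp A W' u ⊆ comp B W u
    C'⊆C = C'.comp-least (C.comp-∋ u∈W) λ {x} x∈C y∈W' Axy →
      let y∈W , y≢v = W'⊆W∖v y∈W' in
      C.comp-closed x∈C y∈W (keep (y≢v ∘ proj₂) (≢v-in-C x∈C ∘ proj₁) Axy)

    C⊆C' : comp B W u ⊆ comp A W' u
    C⊆C' = C.comp-least (C'.comp-∋ (W∖v⊆W' u∈W u≢v)) λ x∈C' y∈W Bxy →
      let y∈C = C.comp-closed (C'⊆C x∈C') y∈W Bxy in
      C'.comp-closed x∈C' (W∖v⊆W' y∈W (≢v-in-C y∈C)) (sub Bxy)

  endpoint-cut : ∀ {k S} → SymmetricAdj A → SymmetricAdj B → u ∉ S → v ∉ S → ∣ S ∣ ≡ k →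
                 isOdd ∣ comp B (∁ S) u ∣ ≡ true → v ∉ comp B (∁ S) u → 1 < ∣ comp B (∁ S) v ∣ →
                 VertexCut A (S ∪ ⁅ v ⁆) × PropertyQ A k u v (S ∪ ⁅ v ⁆)
  endpoint-cut {k} {S} A-sym B-sym u∉S v∉S ∣S∣≡k Cu-odd v∉Cu 1<∣Cv∣ =
      Components.two-components A W' A-sym u∈W' w∈W' w∉C'u
    , trans (∣p∪⁅x⁆∣≡1+∣p∣ S v v∉S) (cong suc ∣S∣≡k)
    , []=⇒lookup (x∈p∪q⁺ {p = S} (inj₂ (x∈⁅x⁆ v)))
    , ∉⇒lookup≡false (x∈∁p⇒x∉p u∈W')
    , subst (λ C → isOdd ∣ C ∣ ≡ true) (sym C'u≡Cu) Cu-odd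
    , λ w w∈C'u Awv → comp-neighbour-of-endpoint v∈W v∉Cu
                        (subst (w ∈_) C'u≡Cu (lookup⇒[]= w _ w∈C'u)) Awv
    where
    W W' : Subset n
    W  = ∁ S
    W' = ∁ (S ∪ ⁅ v ⁆)

    u∈W : u ∈ W
    u∈W = x∉p⇒x∈∁p u∉S

    v∈W : v ∈ W
    v∈W = x∉p⇒x∈∁p v∉S

    u∈W' : u ∈ W'
    u∈W' = ∈∁[p∪⁅x⁆]⁺ u∈W u≢v

    C'u≡Cu : comp A W' u ≡ comp B W u
    C'u≡Cu = comp-delete-endpoint ∈∁[p∪⁅x⁆]⁻ ∈∁[p∪⁅x⁆]⁺ u∈W v∉Cu

    other : ∃ λ w → w ∈ comp B W v × w ≢ v
    other = 1<∣p∣⇒∃y≢x∈p (comp B W v) v 1<∣Cv∣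

    w : Fin n
    w = proj₁ other

    w∈Cv : w ∈ comp B W v
    w∈Cv = proj₁ (proj₂ other)

    w∈W' : w ∈ W'
    w∈W' = ∈∁[p∪⁅x⁆]⁺ (Components.comp-⊆ B W w∈Cv) (proj₂ (proj₂ other))

    w∉C'u : w ∉ comp A W' u
    w∉C'u w∈C'u = v∉Cu (Components.comp-meet B W B-sym v∈W (subst (w ∈_) C'u≡Cu w∈C'u) w∈Cv)

lemma3p8 : ∀ {n : ℕ} (k : ℕ) (A : Adj n) (u v : Fin n) (S : Subset n) →
    2 ≤ k → IsSimple A → ClawFree A → MinimalFactorCritical A k →
    A u v ≡ true → k + 2 ≤ deg A u → k + 2 ≤ deg A v →
    IsSuv A k u v S → Type1 A k u v S →
    (VertexCut A (S ∪ ⁅ v ⁆) × PropertyQ A k u v (S ∪ ⁅ v ⁆)) ×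
    (VertexCut A (S ∪ ⁅ u ⁆) × PropertyQ A k v u (S ∪ ⁅ u ⁆))
lemma3p8 k A u v S _ simple _ _ uv∈E _ _
         ((Su , Sv , _ , _ , Cu-odd , Cv-odd , Cu∌v) , _) (∣S∣≡k , _ , _ , odd⇒nontrivial) =
    endpoint-cut del u≢v A-sym B-sym u∉S v∉S ∣S∣≡k Cu-odd v∉Cu (odd⇒nontrivial v v∈W Cv-odd)
  , endpoint-cut (WithoutEdge-swap del) (u≢v ∘ sym) A-sym B-sym v∉S u∉S ∣S∣≡k Cv-odd u∉Cv
                 (odd⇒nontrivial u u∈W Cu-odd)
  where
  A-sym : SymmetricAdj A
  A-sym = IsSimple.sym simple

  B-sym : SymmetricAdj (delEdge A u v)
  B-sym = delEdge-sym A u v A-sym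

  del : WithoutEdge A u v (delEdge A u v)
  del = delEdge-WithoutEdge A u v

  u≢v : u ≢ v
  u≢v refl with trans (sym uv∈E) (IsSimple.irrefl simple u)
  ... | ()

  u∉S : u ∉ S
  u∉S = lookup≡false⇒∉ Su

  v∉S : v ∉ S
  v∉S = lookup≡false⇒∉ Sv

  u∈W : lookup (∁ S) u ≡ true
  u∈W = []=⇒lookup (x∉p⇒x∈∁p u∉S)

  v∈W : lookup (∁ S) v ≡ true
  v∈W = []=⇒lookup (x∉p⇒x∈∁p v∉S)

  v∉Cu : v ∉ comp (delEdge A u v) (∁ S) u
  v∉Cu = lookup≡false⇒∉ Cu∌v

  u∉Cv : u ∉ comp (delEdge A u v) (∁ S) v
  u∉Cv u∈Cv = v∉Cu (Components.comp-sym (delEdge A u v) (∁ S) B-sym (x∉p⇒x∈∁p v∉S) u∈Cv)
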